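{- Let $\mathbb{K}$ be a field of characteristic $0$. Let $b,g\in\mathbb{K}[[t]]$ have nonzero constant terms with $g$ even, $g(t)=\sum_{n\ge0}g_{2n}t^{2n}$, and let $f_1,f_2\in\mathbb{K}[[t]]$ be odd of order $1$, $f_i(t)=\sum_{n\ge0}f_{i,2n+1}t^{2n+1}$ with $f_{i,1}\neq0$. Let $D=(b|g;f_1,f_2)$ be the double almost-Riordan array. For $u(t)=\sum_{n\ge0}u_nt^n\in\mathbb{K}[[t]]$ let $v(t)$ denote the generating function of the column vector $D\,(u_0,u_1,u_2,\ldots)^T$ (written $D\,u(t)=v(t)$). (a) If $u$ is even, $u(t)=\sum_{k\ge0}u_{2k}t^{2k}$, then $$v(t)=u_0\,b(t)+\frac{t g(t)}{f_2(t)}\Big(u\big(\sqrt{f_1f_2}\big)-u_0\Big).$$ (b) If $u$ is odd, $u(t)=\sum_{k\ge0}u_{2k+1}t^{2k+1}$, then $$v(t)=\frac{t g(t)}{\sqrt{f_1f_2}}\,u\big(\sqrt{f_1f_2}\big).$$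
   Context: The double almost-Riordan array $(b|g;f_1,f_2)$ is the infinite lower triangular matrix $(d_{n,k})_{n,k\ge0}$ whose $k$-th column has generating function $\sum_{n}d_{n,k}t^n$ equal to $b$ for $k=0$, to $t g (f_1f_2)^{\ell}$ for $k=2\ell+1$, and to $t g f_1 (f_1f_2)^{\ell}$ for $k=2\ell+2$ ($\ell\ge0$); i.e. its columns are $(b,\ tg,\ tgf_1,\ tgf_1f_2,\ tgf_1^2f_2,\ tgf_1^2f_2^2,\ldots)$. Notation: for even $u$, $u(\sqrt{f_1f_2})$ means $\sum_{k\ge0}u_{2k}(f_1f_2)^k$, so that $\frac{tg}{f_2}(u(\sqrt{f_1f_2})-u_0)=tgf_1\sum_{k\ge1}u_{2k}(f_1f_2)^{k-1}$; for odd $u$, $\frac{1}{\sqrt{f_1f_2}}u(\sqrt{f_1f_2})$ means $\sum_{k\ge0}u_{2k+1}(f_1f_2)^k$. -}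

module Defs where

open import Level using (Level; _⊔_) renaming (suc to lsuc)
open import Data.Nat using (ℕ; zero; suc) renaming (_+_ to _+ℕ_; _∸_ to _∸ℕ_)
open import Data.Product using (Σ; ∃; _×_)
open import Relation.Nullary using (¬_)
open import Algebra.Bundles using (CommutativeRing)

record Field (c ℓ : Level) : Set (lsuc (c ⊔ ℓ)) where
  field
    commutativeRing : CommutativeRing c ℓ
  open CommutativeRing commutativeRing public
  field
    0≉1     : ¬ (0# ≈ 1#)
    inverse : ∀ x → ¬ (x ≈ 0#) → ∃ λ y → x * y ≈ 1#

module PowerSeries {c ℓ : Level} (R : CommutativeRing c ℓ) where
  open CommutativeRing R using (Carrier; _≈_; _+_; _*_; 0#; 1#)

  fromℕ : ℕ → Carrier
  fromℕ zero    = 0#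
  fromℕ (suc n) = 1# + fromℕ n

  CharZero : Set ℓ
  CharZero = ∀ n → ¬ (fromℕ (suc n) ≈ 0#)

  Series : Set c
  Series = ℕ → Carrier

  sumTo : ℕ → (ℕ → Carrier) → Carrier
  sumTo zero    f = f zero
  sumTo (suc n) f = sumTo n f + f (suc n)

  _≋_ : Series → Series → Set ℓ
  s ≋ s' = ∀ n → s n ≈ s' n

  zeroS : Series
  zeroS _ = 0#

  oneS : Series
  oneS zero    = 1#
  oneS (suc _) = 0#

  _⊕_ : Series → Series → Series
  (s ⊕ s') n = s n + s' n

  _·_ : Carrier → Series → Series
  (a · s) n = a * s n

  _⊛_ : Series → Series → Series
  (s ⊛ s') n = sumTo n (λ i → s i * s' (n ∸ℕ i))

  tS : Series → Series
  tS s zero    = 0#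
  tS s (suc n) = s n

  _^S_ : Series → ℕ → Series
  s ^S zero  = oneS
  s ^S suc k = s ⊛ (s ^S k)

  -- composition u(h) = Σ_k u_k h^k, for h with zero constant term
  -- (the terms with k > n do not contribute to [t^n]).
  compose : Series → Series → Series
  compose u h n = sumTo n (λ k → u k * (h ^S k) n)

  IsEven : Series → Set ℓ
  IsEven s = ∀ n → s (suc (n +ℕ n)) ≈ 0#

  IsOdd : Series → Set ℓ
  IsOdd s = ∀ n → s (n +ℕ n) ≈ 0#

  -- Double almost-Riordan array (b|g;f₁,f₂).
  -- factor k: f₁^{⌈k/2⌉} f₂^{⌊k/2⌋}, i.e. 1, f₁, f₁f₂, f₁²f₂, (f₁f₂)², ...
  module DoubleAlmostRiordan (b g f₁ f₂ : Series) where
    factor : ℕ → Series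
    factor zero          = oneS
    factor (suc zero)    = f₁
    factor (suc (suc k)) = (f₁ ⊛ f₂) ⊛ factor k

    -- generating function of column k: b, tg, tgf₁, tgf₁f₂, tgf₁²f₂, ...
    column : ℕ → Series
    column zero    = b
    column (suc k) = tS g ⊛ factor k

    entry : ℕ → ℕ → Carrier
    entry n k = column k n

    -- D applied to the coefficient vector of u (lower triangular: finite sum)
    apply : Series → Series
    apply u n = sumTo n (λ k → entry n k * u k)

  dar : (b g f₁ f₂ : Series) → Series → Series
  dar b g f₁ f₂ = DoubleAlmostRiordan.apply b g f₁ f₂

  -- Σ_{k≥1} u_{2k} s^{k-1}  (so that u(√(f₁f₂)) - u₀ = f₁f₂ · evenTail u (f₁f₂))
  evenTailCoeffs : Series → Series
  evenTailCoeffs u k = u (suc (suc (k +ℕ k)))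

  -- Σ_{k≥0} u_{2k+1} s^k  (so that (1/√s) u(√s) = compose (oddCoeffs u) s)
  oddCoeffs : Series → Series
  oddCoeffs u k = u (suc (k +ℕ k))

-- Columns 2j and 2j+1 of D are t g f₁ (f₁f₂)^(j-1) and t g (f₁f₂)^j, so splitting
-- D u = Σ_k u_k (column k) by the parity of k and collecting each parity class
-- into a composition with f₁f₂ gives both formulas. The only other input is that
-- column k has order at least k (from f₁(0) = f₂(0) = 0), so that all sums are
-- finite.
module Submission where

open import Defs
open import Level using (Level)
open import Data.Product using (_×_; _,_)
open import Relation.Nullary using (¬_; yes; no)
open import Data.Nat using (ℕ; zero; suc; z≤n; s≤s; _≤′_; ≤′-refl; ≤′-step; _<?_)
  renaming (_+_ to _+ℕ_; _∸_ to _∸ℕ_; _≤_ to _≤ℕ_; _<_ to _<ℕ_)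
open import Data.Nat.Properties
  using (≤-refl; ≤-trans; ≤-<-trans; m≤n⇒m≤1+n; n≤1+n; m≤m+n; m∸n≤m; m∸[m∸n]≡n;
         ≮⇒≥; +-suc; ≤⇒≤′; ≤′⇒≤)
open import Relation.Binary.PropositionalEquality using (cong)
open import Algebra.Bundles using (CommutativeRing)
import Relation.Binary.Reasoning.Setoid as SetoidReasoning
import Algebra.Properties.CommutativeSemigroup as CommutativeSemigroupProperties

m<n+o∧n≤k⇒m∸k<o : ∀ m n o k → m <ℕ n +ℕ o → n ≤ℕ k → k ≤ℕ m → m ∸ℕ k <ℕ o
m<n+o∧n≤k⇒m∸k<o m       zero    o k       m<o       _         _         =
  ≤-<-trans (m∸n≤m m k) m<o
m<n+o∧n≤k⇒m∸k<o (suc m) (suc n) o (suc k) (s≤s m<n+o) (s≤s n≤k) (s≤s k≤m) =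
  m<n+o∧n≤k⇒m∸k<o m n o k m<n+o n≤k k≤m

module PowerSeriesProperties {c ℓ : Level} (R : CommutativeRing c ℓ) where
  open CommutativeRing R
  open PowerSeries R
  open SetoidReasoning setoid
  open CommutativeSemigroupProperties +-commutativeSemigroup using (interchange)

  sumTo-cong : ∀ n {f h : ℕ → Carrier} → (∀ i → i ≤ℕ n → f i ≈ h i) →
               sumTo n f ≈ sumTo n h
  sumTo-cong zero    f≈h = f≈h 0 z≤n
  sumTo-cong (suc n) f≈h =
    +-cong (sumTo-cong n (λ i i≤n → f≈h i (m≤n⇒m≤1+n i≤n))) (f≈h (suc n) ≤-refl)

  sumTo-zero : ∀ n {f : ℕ → Carrier} → (∀ i → i ≤ℕ n → f i ≈ 0#) → sumTo n f ≈ 0#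
  sumTo-zero n {f} f≈0 = trans (sumTo-cong n f≈0) (sumTo-const-0 n)
    where
    sumTo-const-0 : ∀ n → sumTo n (λ _ → 0#) ≈ 0#
    sumTo-const-0 zero    = refl
    sumTo-const-0 (suc n) = trans (+-cong (sumTo-const-0 n) refl) (+-identityˡ 0#)

  sumTo-+ : ∀ n (f h : ℕ → Carrier) →
            sumTo n (λ i → f i + h i) ≈ sumTo n f + sumTo n h
  sumTo-+ zero    f h = refl
  sumTo-+ (suc n) f h = trans (+-cong (sumTo-+ n f h) refl) (interchange _ _ _ _)

  *-distribˡ-sumTo : ∀ n a (f : ℕ → Carrier) → a * sumTo n f ≈ sumTo n (λ i → a * f i)
  *-distribˡ-sumTo zero    a f = refl
  *-distribˡ-sumTo (suc n) a f = trans (distribˡ a _ _) (+-cong (*-distribˡ-sumTo n a f) refl)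

  *-distribʳ-sumTo : ∀ n a (f : ℕ → Carrier) → sumTo n f * a ≈ sumTo n (λ i → f i * a)
  *-distribʳ-sumTo zero    a f = refl
  *-distribʳ-sumTo (suc n) a f = trans (distribʳ a _ _) (+-cong (*-distribʳ-sumTo n a f) refl)

  sumTo-unfoldˡ : ∀ n (f : ℕ → Carrier) → sumTo (suc n) f ≈ f 0 + sumTo n (λ i → f (suc i))
  sumTo-unfoldˡ zero    f = refl
  sumTo-unfoldˡ (suc n) f = trans (+-cong (sumTo-unfoldˡ n f) refl) (+-assoc _ _ _)

  sumTo-reverse : ∀ n (f : ℕ → Carrier) → sumTo n f ≈ sumTo n (λ i → f (n ∸ℕ i))
  sumTo-reverse zero    f = refl
  sumTo-reverse (suc n) f = sym (begin
    sumTo (suc n) (λ i → f (suc n ∸ℕ i))   ≈⟨ sumTo-unfoldˡ n _ ⟩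
    f (suc n) + sumTo n (λ i → f (n ∸ℕ i)) ≈⟨ +-cong refl (sym (sumTo-reverse n f)) ⟩
    f (suc n) + sumTo n f                  ≈⟨ +-comm _ _ ⟩
    sumTo (suc n) f                        ∎)

  sumTo-swap : ∀ n m (F : ℕ → ℕ → Carrier) →
               sumTo n (λ i → sumTo m (F i)) ≈ sumTo m (λ k → sumTo n (λ i → F i k))
  sumTo-swap zero    m F = refl
  sumTo-swap (suc n) m F = begin
    sumTo n (λ i → sumTo m (F i)) + sumTo m (F (suc n))
      ≈⟨ +-cong (sumTo-swap n m F) refl ⟩
    sumTo m (λ k → sumTo n (λ i → F i k)) + sumTo m (F (suc n))
      ≈⟨ sym (sumTo-+ m _ _) ⟩
    sumTo m (λ k → sumTo (suc n) (λ i → F i k)) ∎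

  sumTo-extend : ∀ n m (f : ℕ → Carrier) → (∀ k → n <ℕ k → f k ≈ 0#) → n ≤ℕ m →
                 sumTo n f ≈ sumTo m f
  sumTo-extend n m f f≈0 n≤m = extend m (≤⇒≤′ n≤m)
    where
    extend : ∀ m → n ≤′ m → sumTo n f ≈ sumTo m f
    extend m       ≤′-refl        = refl
    extend (suc m) (≤′-step n≤′m) =
      trans (sym (+-identityʳ _))
            (+-cong (extend m n≤′m) (sym (f≈0 (suc m) (s≤s (≤′⇒≤ n≤′m)))))

  sumTo-evens-odds : ∀ M (f : ℕ → Carrier) →
    sumTo (suc (M +ℕ M)) f ≈ sumTo M (λ j → f (j +ℕ j)) + sumTo M (λ j → f (suc (j +ℕ j)))
  sumTo-evens-odds zero    f = refl
  sumTo-evens-odds (suc M) f rewrite +-suc M M = begin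
    (sumTo (suc (M +ℕ M)) f + f (2+2M)) + f (3+2M)
      ≈⟨ +-cong (+-cong (sumTo-evens-odds M f) refl) refl ⟩
    ((evens + odds) + f (2+2M)) + f (3+2M)
      ≈⟨ +-assoc _ _ _ ⟩
    (evens + odds) + (f (2+2M) + f (3+2M))
      ≈⟨ interchange _ _ _ _ ⟩
    (evens + f (2+2M)) + (odds + f (3+2M)) ∎
    where
    2+2M 3+2M : ℕ
    2+2M  = suc (suc (M +ℕ M))
    3+2M  = suc 2+2M
    evens = sumTo M (λ j → f (j +ℕ j))
    odds  = sumTo M (λ j → f (suc (j +ℕ j)))

  shift : Series → Series
  shift s i = s (suc i)

  ⊛-congˡ : ∀ {s s'} r → s ≋ s' → (s ⊛ r) ≋ (s' ⊛ r)
  ⊛-congˡ r s≋s' n = sumTo-cong n (λ i _ → *-cong (s≋s' i) refl)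

  ⊛-congʳ : ∀ s {r r'} → r ≋ r' → (s ⊛ r) ≋ (s ⊛ r')
  ⊛-congʳ s r≋r' n = sumTo-cong n (λ i _ → *-cong refl (r≋r' (n ∸ℕ i)))

  shift-⊛ : ∀ s r → shift (s ⊛ r) ≋ ((s 0 · shift r) ⊕ (shift s ⊛ r))
  shift-⊛ s r n = sumTo-unfoldˡ n (λ i → s i * r (suc n ∸ℕ i))

  ⊛-comm : ∀ s r → (s ⊛ r) ≋ (r ⊛ s)
  ⊛-comm s r n = trans (sumTo-reverse n _) (sumTo-cong n (λ i i≤n →
    trans (*-cong refl (reflexive (cong r (m∸[m∸n]≡n i≤n)))) (*-comm _ _)))

  ⊛-distribʳ-⊕ : ∀ s s' r → ((s ⊕ s') ⊛ r) ≋ ((s ⊛ r) ⊕ (s' ⊛ r))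
  ⊛-distribʳ-⊕ s s' r n = trans (sumTo-cong n (λ i _ → distribʳ _ _ _)) (sumTo-+ n _ _)

  ·-⊛-assoc : ∀ a s r → ((a · s) ⊛ r) ≋ (a · (s ⊛ r))
  ·-⊛-assoc a s r n =
    trans (sumTo-cong n (λ i _ → *-assoc _ _ _)) (sym (*-distribˡ-sumTo n a _))

  ⊛-assoc : ∀ s r q → ((s ⊛ r) ⊛ q) ≋ (s ⊛ (r ⊛ q))
  ⊛-assoc s r q zero    = *-assoc _ _ _
  ⊛-assoc s r q (suc n) = begin
    ((s ⊛ r) ⊛ q) (suc n)
      ≈⟨ shift-⊛ (s ⊛ r) q n ⟩
    (s 0 * r 0) * q (suc n) + (shift (s ⊛ r) ⊛ q) n
      ≈⟨ +-cong (*-assoc _ _ _) (⊛-congˡ q (shift-⊛ s r) n) ⟩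
    s 0 * (r 0 * q (suc n)) + (((s 0 · shift r) ⊕ (shift s ⊛ r)) ⊛ q) n
      ≈⟨ +-cong refl (⊛-distribʳ-⊕ _ _ q n) ⟩
    s 0 * (r 0 * q (suc n)) + (((s 0 · shift r) ⊛ q) n + ((shift s ⊛ r) ⊛ q) n)
      ≈⟨ +-cong refl (+-cong (·-⊛-assoc (s 0) (shift r) q n) (⊛-assoc (shift s) r q n)) ⟩
    s 0 * (r 0 * q (suc n)) + (s 0 * (shift r ⊛ q) n + (shift s ⊛ (r ⊛ q)) n)
      ≈⟨ sym (+-assoc _ _ _) ⟩
    (s 0 * (r 0 * q (suc n)) + s 0 * (shift r ⊛ q) n) + (shift s ⊛ (r ⊛ q)) n
      ≈⟨ +-cong (sym (distribˡ _ _ _)) refl ⟩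
    s 0 * (r 0 * q (suc n) + (shift r ⊛ q) n) + (shift s ⊛ (r ⊛ q)) n
      ≈⟨ +-cong (*-cong refl (sym (shift-⊛ r q n))) refl ⟩
    s 0 * (r ⊛ q) (suc n) + (shift s ⊛ (r ⊛ q)) n
      ≈⟨ sym (shift-⊛ s (r ⊛ q) n) ⟩
    (s ⊛ (r ⊛ q)) (suc n) ∎

  ⊛-identityʳ : ∀ s → (s ⊛ oneS) ≋ s
  ⊛-identityʳ s n = trans (⊛-comm s oneS n) (identityˡ n)
    where
    identityˡ : (oneS ⊛ s) ≋ s
    identityˡ zero    = *-identityˡ _
    identityˡ (suc n) =
      trans (shift-⊛ oneS s n)
            (trans (+-cong (*-identityˡ _) (sumTo-zero n (λ i _ → zeroˡ _))) (+-identityʳ _))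

  OrderAtLeast : Series → ℕ → Set ℓ
  OrderAtLeast s a = ∀ n → n <ℕ a → s n ≈ 0#

  orderAtLeast-1 : ∀ {s} → s 0 ≈ 0# → OrderAtLeast s 1
  orderAtLeast-1 s₀≈0 zero (s≤s z≤n) = s₀≈0

  tS-orderAtLeast-1 : ∀ s → OrderAtLeast (tS s) 1
  tS-orderAtLeast-1 s = orderAtLeast-1 refl

  ⊛-orderAtLeast : ∀ s r a b → OrderAtLeast s a → OrderAtLeast r b →
                   OrderAtLeast (s ⊛ r) (a +ℕ b)
  ⊛-orderAtLeast s r a b ord-s ord-r n n<a+b = sumTo-zero n term≈0
    where
    term≈0 : ∀ i → i ≤ℕ n → s i * r (n ∸ℕ i) ≈ 0#
    term≈0 i i≤n with i <? a
    ... | yes i<a = trans (*-cong (ord-s i i<a) refl) (zeroˡ _)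
    ... | no  i≮a = trans (*-cong refl (ord-r (n ∸ℕ i)
                      (m<n+o∧n≤k⇒m∸k<o n a b i n<a+b (≮⇒≥ i≮a) i≤n))) (zeroʳ _)

  ^S-orderAtLeast : ∀ q → OrderAtLeast q 1 → ∀ k → OrderAtLeast (q ^S k) k
  ^S-orderAtLeast q ord-q zero    n ()
  ^S-orderAtLeast q ord-q (suc k) =
    ⊛-orderAtLeast q (q ^S k) 1 k ord-q (^S-orderAtLeast q ord-q k)

  -- Since q^k has order ≥ k, truncating u(q) at any degree M ≥ n leaves [t^n] unchanged.
  ⊛-compose-coeff : ∀ s u q → OrderAtLeast q 1 → ∀ n M → n ≤ℕ M →
                    (s ⊛ compose u q) n ≈ sumTo M (λ k → (s ⊛ (q ^S k)) n * u k)
  ⊛-compose-coeff s u q ord-q n M n≤M = begin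
    sumTo n (λ i → s i * sumTo (n ∸ℕ i) (λ k → u k * (q ^S k) (n ∸ℕ i)))
      ≈⟨ sumTo-cong n (λ i _ → *-cong refl (sumTo-extend (n ∸ℕ i) M _
           (λ k n∸i<k → trans (*-cong refl (^S-orderAtLeast q ord-q k (n ∸ℕ i) n∸i<k)) (zeroʳ _))
           (≤-trans (m∸n≤m n i) n≤M))) ⟩
    sumTo n (λ i → s i * sumTo M (λ k → u k * (q ^S k) (n ∸ℕ i)))
      ≈⟨ sumTo-cong n (λ i _ → *-distribˡ-sumTo M (s i) _) ⟩
    sumTo n (λ i → sumTo M (λ k → s i * (u k * (q ^S k) (n ∸ℕ i))))
      ≈⟨ sumTo-swap n M _ ⟩
    sumTo M (λ k → sumTo n (λ i → s i * (u k * (q ^S k) (n ∸ℕ i))))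
      ≈⟨ sumTo-cong M (λ k _ → trans (sumTo-cong n (λ i _ → x*[y*z]≈[x*z]*y _ _ _))
                                     (sym (*-distribʳ-sumTo n (u k) _))) ⟩
    sumTo M (λ k → (s ⊛ (q ^S k)) n * u k) ∎
    where
    x*[y*z]≈[x*z]*y : ∀ x y z → x * (y * z) ≈ (x * z) * y
    x*[y*z]≈[x*z]*y x y z = trans (*-cong refl (*-comm y z)) (sym (*-assoc x z y))

  module DoubleAlmostRiordanProperties (b g f₁ f₂ : Series)
                                       (f₁₀≈0 : f₁ 0 ≈ 0#) (f₂₀≈0 : f₂ 0 ≈ 0#) where
    open DoubleAlmostRiordan b g f₁ f₂

    f₁f₂ : Series
    f₁f₂ = f₁ ⊛ f₂

    f₁f₂-orderAtLeast-2 : OrderAtLeast f₁f₂ 2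
    f₁f₂-orderAtLeast-2 =
      ⊛-orderAtLeast f₁ f₂ 1 1 (orderAtLeast-1 f₁₀≈0) (orderAtLeast-1 f₂₀≈0)

    f₁f₂-orderAtLeast-1 : OrderAtLeast f₁f₂ 1
    f₁f₂-orderAtLeast-1 n (s≤s z≤n) = f₁f₂-orderAtLeast-2 n (s≤s z≤n)

    factor-even : ∀ j → factor (j +ℕ j) ≋ (f₁f₂ ^S j)
    factor-even zero                      = λ _ → refl
    factor-even (suc j) rewrite +-suc j j = ⊛-congʳ f₁f₂ (factor-even j)

    factor-odd : ∀ j → factor (suc (j +ℕ j)) ≋ (f₁ ⊛ (f₁f₂ ^S j))
    factor-odd zero    n                   = sym (⊛-identityʳ f₁ n)
    factor-odd (suc j) n rewrite +-suc j j = begin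
      (f₁f₂ ⊛ factor (suc (j +ℕ j))) n ≈⟨ ⊛-congʳ f₁f₂ (factor-odd j) n ⟩
      (f₁f₂ ⊛ (f₁ ⊛ (f₁f₂ ^S j))) n    ≈⟨ sym (⊛-assoc f₁f₂ f₁ (f₁f₂ ^S j) n) ⟩
      ((f₁f₂ ⊛ f₁) ⊛ (f₁f₂ ^S j)) n    ≈⟨ ⊛-congˡ (f₁f₂ ^S j) (⊛-comm f₁f₂ f₁) n ⟩
      ((f₁ ⊛ f₁f₂) ⊛ (f₁f₂ ^S j)) n    ≈⟨ ⊛-assoc f₁ f₁f₂ (f₁f₂ ^S j) n ⟩
      (f₁ ⊛ (f₁f₂ ⊛ (f₁f₂ ^S j))) n    ∎

    factor-orderAtLeast : ∀ k → OrderAtLeast (factor k) k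
    factor-orderAtLeast zero          n ()
    factor-orderAtLeast (suc zero)    = orderAtLeast-1 f₁₀≈0
    factor-orderAtLeast (suc (suc k)) =
      ⊛-orderAtLeast f₁f₂ (factor k) 2 k f₁f₂-orderAtLeast-2 (factor-orderAtLeast k)

    column-orderAtLeast : ∀ k → OrderAtLeast (column k) k
    column-orderAtLeast zero    n ()
    column-orderAtLeast (suc k) =
      ⊛-orderAtLeast (tS g) (factor k) 1 k (tS-orderAtLeast-1 g) (factor-orderAtLeast k)

    column-odd : ∀ j → column (suc (j +ℕ j)) ≋ (tS g ⊛ (f₁f₂ ^S j))
    column-odd j = ⊛-congʳ (tS g) (factor-even j)

    column-even : ∀ j → column (suc (suc (j +ℕ j))) ≋ ((tS g ⊛ f₁) ⊛ (f₁f₂ ^S j))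
    column-even j n = trans (⊛-congʳ (tS g) (factor-odd j) n) (sym (⊛-assoc (tS g) f₁ (f₁f₂ ^S j) n))

    apply-evens-odds : ∀ u n → apply u n ≈
      sumTo (suc n) (λ j → column (j +ℕ j) n * u (j +ℕ j))
        + sumTo (suc n) (λ j → column (suc (j +ℕ j)) n * u (suc (j +ℕ j)))
    apply-evens-odds u n = trans
      (sumTo-extend n (suc (suc n +ℕ suc n)) _
        (λ k n<k → trans (*-cong (column-orderAtLeast k n n<k) refl) (zeroˡ _))
        (≤-trans (m≤m+n n (suc n)) (≤-trans (n≤1+n _) (n≤1+n _))))
      (sumTo-evens-odds (suc n) (λ k → column k n * u k))

    apply-even : ∀ u → IsEven u →
      apply u ≋ ((u 0 · b) ⊕ ((tS g ⊛ f₁) ⊛ compose (evenTailCoeffs u) f₁f₂))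
    apply-even u u-even n = begin
      apply u n
        ≈⟨ apply-evens-odds u n ⟩
      _ ≈⟨ +-cong (sumTo-unfoldˡ n _) (sumTo-zero (suc n) (λ j _ → odd-term≈0 j)) ⟩
      (b n * u 0 + sumTo n (λ j → column (suc j +ℕ suc j) n * u (suc j +ℕ suc j))) + 0#
        ≈⟨ +-identityʳ _ ⟩
      b n * u 0 + sumTo n (λ j → column (suc j +ℕ suc j) n * u (suc j +ℕ suc j))
        ≈⟨ +-cong (*-comm _ _) (sumTo-cong n (λ j _ → even-term j)) ⟩
      u 0 * b n + sumTo n (λ j → ((tS g ⊛ f₁) ⊛ (f₁f₂ ^S j)) n * evenTailCoeffs u j)
        ≈⟨ +-cong refl (sym (⊛-compose-coeff (tS g ⊛ f₁) (evenTailCoeffs u) f₁f₂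
                               f₁f₂-orderAtLeast-1 n n ≤-refl)) ⟩
      u 0 * b n + ((tS g ⊛ f₁) ⊛ compose (evenTailCoeffs u) f₁f₂) n ∎
      where
      odd-term≈0 : ∀ j → column (suc (j +ℕ j)) n * u (suc (j +ℕ j)) ≈ 0#
      odd-term≈0 j = trans (*-cong refl (u-even j)) (zeroʳ _)

      even-term : ∀ j → column (suc j +ℕ suc j) n * u (suc j +ℕ suc j)
                      ≈ ((tS g ⊛ f₁) ⊛ (f₁f₂ ^S j)) n * evenTailCoeffs u j
      even-term j = trans (reflexive (cong (λ k → column k n * u k) (cong suc (+-suc j j))))
                          (*-cong (column-even j n) refl)

    apply-odd : ∀ u → IsOdd u → apply u ≋ (tS g ⊛ compose (oddCoeffs u) f₁f₂)
    apply-odd u u-odd n = begin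
      apply u n
        ≈⟨ apply-evens-odds u n ⟩
      _ ≈⟨ +-cong (sumTo-zero (suc n) (λ j _ → trans (*-cong refl (u-odd j)) (zeroʳ _)))
                  (sumTo-cong (suc n) (λ j _ → *-cong (column-odd j n) refl)) ⟩
      0# + sumTo (suc n) (λ j → (tS g ⊛ (f₁f₂ ^S j)) n * oddCoeffs u j)
        ≈⟨ +-identityˡ _ ⟩
      sumTo (suc n) (λ j → (tS g ⊛ (f₁f₂ ^S j)) n * oddCoeffs u j)
        ≈⟨ sym (⊛-compose-coeff (tS g) (oddCoeffs u) f₁f₂ f₁f₂-orderAtLeast-1
                               n (suc n) (n≤1+n n)) ⟩
      (tS g ⊛ compose (oddCoeffs u) f₁f₂) n ∎

theorem2p2 : {c ℓ : Level} (F : Field c ℓ) →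
    let open Field F
        open PowerSeries commutativeRing
    in CharZero →
       (b g f₁ f₂ : Series) →
       ¬ (b 0 ≈ 0#) → ¬ (g 0 ≈ 0#) → IsEven g →
       IsOdd f₁ → ¬ (f₁ 1 ≈ 0#) → IsOdd f₂ → ¬ (f₂ 1 ≈ 0#) →
       (u : Series) →
       (IsEven u →
          dar b g f₁ f₂ u ≋ ((u 0 · b) ⊕ ((tS g ⊛ f₁) ⊛ compose (evenTailCoeffs u) (f₁ ⊛ f₂))))
       × (IsOdd u →
          dar b g f₁ f₂ u ≋ (tS g ⊛ compose (oddCoeffs u) (f₁ ⊛ f₂)))
theorem2p2 F _ b g f₁ f₂ _ _ _ f₁-odd _ f₂-odd _ u = D.apply-even u , D.apply-odd u
  where
  open PowerSeriesProperties (Field.commutativeRing F)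
  module D = DoubleAlmostRiordanProperties b g f₁ f₂ (f₁-odd 0) (f₂-odd 0)
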